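{- Let $X$ be a finite set and suppose that $N_1,\dots,N_k\subseteq X$ (distinct sets) form a $(p,\epsilon)$-robust sunflower with kernel $K$. Then for every $i\in[k]$, the sets $N_1,\dots,N_{i-1},N_{i+1},\dots,N_k$ form a $(2p,2\epsilon)$-robust sunflower with kernel $K$, in the sense that $\Pr_{\bm{R}}[\exists j\ne i: N_j\subseteq \bm{R}\mid \bm{R}\supseteq K]\ge 1-2\epsilon$, where $\bm{R}\subseteq X$ contains each element independently with probability $2p$.
   Context: For a family $\mathcal{F}$ of subsets of $X$ with kernel $K=\bigcap_{S\in\mathcal{F}}S$, $\mathcal{F}$ is an $(\alpha,\beta)$-robust sunflower ($0<\alpha,\beta<1$) if $K\notin\mathcal{F}$ and $\Pr_{\bm{R}}[\exists S\in\mathcal{F}: S\subseteq \bm{R}\cup K]\ge 1-\beta$, where $\bm{R}$ contains each element of $X$ independently with probability $\alpha$; equivalently $\Pr[\exists S\in\mathcal{F}: \bm{R}\supseteq S\mid \bm{R}\supseteq K]\ge 1-\beta$.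
   Formalization: The parameters p and ε are rational numbers. -}

module Defs where

open import Data.Nat using (ℕ; zero; suc)
open import Data.Bool using (Bool; if_then_else_)
open import Data.Fin using (Fin; _≟_)
open import Data.Fin.Properties using (any?)
open import Data.Fin.Subset using (Subset; inside; outside; _∪_; ⋂)
open import Data.Fin.Subset.Properties using (_⊆?_)
open import Data.List using (tabulate)
open import Data.Vec using ([]; _∷_)
open import Data.Product using (_×_)
open import Relation.Nullary using (does; ¬_; ¬?)
open import Relation.Nullary.Decidable using (_×-dec_)
open import Relation.Binary.PropositionalEquality using (_≡_; _≢_)
open import Data.Rational using (ℚ; 0ℚ; 1ℚ; _+_; _*_; _-_; _≤_; _<_)

-- The ground set X is Fin n; subsets of X are Data.Fin.Subset.
-- A family F = {N_1,...,N_k} is given as N : Fin k → Subset n.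

kernel : ∀ {n k} → (Fin k → Subset n) → Subset n
kernel N = ⋂ (tabulate N)

-- Pr α E : probability that the random set R ⊆ Fin n, containing each
-- element independently with probability α, satisfies the (Boolean) event E.
-- (Product measure, by recursion on the first coordinate.)
Pr : ℚ → (n : ℕ) → (Subset n → Bool) → ℚ
Pr α zero    E = if E [] then 1ℚ else 0ℚ
Pr α (suc n) E = α * Pr α n (λ R → E (inside ∷ R))
               + (1ℚ - α) * Pr α n (λ R → E (outside ∷ R))

coveredBy : ∀ {n k} → (Fin k → Subset n) → Subset n → Subset n → Bool
coveredBy N K R = does (any? (λ j → N j ⊆? (R ∪ K)))

coveredByExcept : ∀ {n k} → (Fin k → Subset n) → Fin k → Subset n → Subset n → Bool
coveredByExcept N i K R = does (any? (λ j → ¬? (j ≟ i) ×-dec (N j ⊆? (R ∪ K))))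

RobustSunflower : ∀ {n k} → ℚ → ℚ → (Fin k → Subset n) → Set
RobustSunflower {n} α β N =
  (0ℚ < α × α < 1ℚ) × (0ℚ < β × β < 1ℚ) ×
  (∀ j → kernel N ≢ N j) ×
  (1ℚ - β ≤ Pr α n (coveredBy N (kernel N)))

{-# OPTIONS --safe #-}
module Submission where

open import Defs
open import Data.Bool using (Bool; true; false; not; _∧_; T)
open import Data.Bool.Properties using (T-∧)
open import Data.Empty using (⊥-elim)
open import Data.Fin using (Fin)
import Data.Fin as Fin
open import Data.Fin.Properties using (any?)
open import Data.Fin.Subset using (Subset; inside; outside; _∪_; _⊆_; _⊂_; _∈_; _∉_)
open import Data.Fin.Subset.Properties
  using (_∈?_; _⊆?_; out⊆; s⊆s; ⊆-refl; ⊆-antisym; x∈p∩q⁻; x∈p∪q⁻; x∈p∪q⁺)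
open import Data.Nat using (ℕ; zero; suc)
open import Data.Product using (∃; _×_; _,_; proj₁; proj₂)
open import Data.Rational using (ℚ; 0ℚ; 1ℚ; _+_; _*_; _-_; -_; _≤_; _<_; positive; nonNegative)
open import Data.Rational.Properties
  using ( ≤-refl; ≤-trans; <⇒≤; +-identityˡ; +-inverseʳ; +-mono-≤; +-monoˡ-≤; +-monoˡ-<
        ; *-monoˡ-≤-nonNeg; *-monoʳ-≤-nonNeg; *-cancelˡ-≤-pos; nonNeg*nonNeg⇒nonNeg; nonNegative⁻¹
        ; module ≤-Reasoning )
open import Data.Rational.Solver using (module +-*-Solver)
open import Data.Sum using (inj₁; inj₂)
open import Data.Vec using (lookup; _∷_; [])
open import Data.Vec.Properties using ([]=⇒lookup)
open import Function using (_∘_; Equivalence)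
open import Function.Definitions using (Injective)
open import Relation.Binary.PropositionalEquality
  using (_≡_; _≢_; refl; sym; cong; cong₂; subst; module ≡-Reasoning)
open import Relation.Nullary using (Dec; does; ¬?; yes; no)
open import Relation.Nullary.Decidable using (_×-dec_)

open +-*-Solver using (solve; _:+_; _:*_; _:-_; _:=_; con)

-- Fix a coordinate x lying in the dropped petal N i but not in the kernel K, and let
-- U be the down-closed event that no other petal is covered.  On x ∉ R the petal
-- N i is not covered either, so Pr[U ∧ x ∉ R] ≤ ε.  Removing x from R maps
-- U ∧ x ∈ R into U ∧ x ∉ R and rescales weights by (1-p)/p, so for p ≤ 1/2 also
-- Pr[U ∧ x ∈ R] ≤ Pr[U ∧ x ∉ R].  Hence Pr_p[U] ≤ 2ε, and raising p to 2p can only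
-- help the up-closed complement of U.

private variable
  n : ℕ
  a b c a′ b′ α β : ℚ

p≤q⇒0≤q-p : a ≤ b → 0ℚ ≤ b - a
p≤q⇒0≤q-p {a} {b} a≤b = subst (_≤ b - a) (+-inverseʳ a) (+-monoˡ-≤ (- a) a≤b)

p<q⇒0<q-p : a < b → 0ℚ < b - a
p<q⇒0<q-p {a} {b} a<b = subst (_< b - a) (+-inverseʳ a) (+-monoˡ-< (- a) a<b)

≤-by-difference : ∀ d → 0ℚ ≤ d → b - a ≡ d → a ≤ b
≤-by-difference {b} {a} d 0≤d b-a≡d = begin
  a               ≡⟨ sym (+-identityˡ a) ⟩
  0ℚ + a          ≤⟨ +-monoˡ-≤ a 0≤d ⟩
  d + a           ≡⟨ cong (_+ a) (sym b-a≡d) ⟩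
  (b - a) + a     ≡⟨ cancel a b ⟩
  b               ∎
  where
  open ≤-Reasoning
  cancel : ∀ a b → (b - a) + a ≡ b
  cancel = solve 2 (λ a b → (b :- a) :+ a := b) refl

0≤p*q : 0ℚ ≤ a → 0ℚ ≤ b → 0ℚ ≤ a * b
0≤p*q {a} {b} 0≤a 0≤b =
  nonNegative⁻¹ (a * b) {{nonNeg*nonNeg⇒nonNeg a {{nonNegative 0≤a}} b {{nonNegative 0≤b}}}}

*-monoˡ-≤ : 0ℚ ≤ c → a ≤ b → c * a ≤ c * b
*-monoˡ-≤ {c} 0≤c = *-monoˡ-≤-nonNeg c {{nonNegative 0≤c}}

complement-≤ : a + b ≡ 1ℚ → 1ℚ - c ≤ a → b ≤ c
complement-≤ {a} {b} {c} a+b≡1 1-c≤a = ≤-by-difference (a - (1ℚ - c)) (p≤q⇒0≤q-p 1-c≤a) (begin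
  c - b              ≡⟨ regroup a b c ⟩
  a - ((a + b) - c)  ≡⟨ cong (λ t → a - (t - c)) a+b≡1 ⟩
  a - (1ℚ - c)       ∎)
  where
  open ≡-Reasoning
  regroup : ∀ a b c → c - b ≡ a - ((a + b) - c)
  regroup = solve 3 (λ a b c → c :- b := a :- ((a :+ b) :- c)) refl

complement-≥ : a + b ≡ 1ℚ → b ≤ c → 1ℚ - c ≤ a
complement-≥ {a} {b} {c} a+b≡1 b≤c = ≤-by-difference (c - b) (p≤q⇒0≤q-p b≤c) (begin
  a - (1ℚ - c)       ≡⟨ cong (λ t → a - (t - c)) (sym a+b≡1) ⟩
  a - ((a + b) - c)  ≡⟨ regroup a b c ⟩
  c - b              ∎)
  where
  open ≡-Reasoning
  regroup : ∀ a b c → a - ((a + b) - c) ≡ c - b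
  regroup = solve 3 (λ a b c → a :- ((a :+ b) :- c) := c :- b) refl

p+p≤1⇒p≤1-p : a + a ≤ 1ℚ → a ≤ 1ℚ - a
p+p≤1⇒p≤1-p {a} a+a≤1 = ≤-by-difference (1ℚ - (a + a)) (p≤q⇒0≤q-p a+a≤1) (regroup a)
  where
  regroup : ∀ a → (1ℚ - a) - a ≡ 1ℚ - (a + a)
  regroup = solve 1 (λ a → (con 1ℚ :- a) :- a := con 1ℚ :- (a :+ a)) refl

0≤p⇒p≤p+p : 0ℚ ≤ a → a ≤ a + a
0≤p⇒p≤p+p {a} 0≤a = ≤-by-difference a 0≤a (regroup a)
  where
  regroup : ∀ a → (a + a) - a ≡ a
  regroup = solve 1 (λ a → (a :+ a) :- a := a) refl

mix : ℚ → ℚ → ℚ → ℚ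
mix α a b = α * a + (1ℚ - α) * b

mix-idem : ∀ α a → mix α a a ≡ a
mix-idem = solve 2 (λ α a → α :* a :+ (con 1ℚ :- α) :* a := a) refl

mix-+ : ∀ α a b a′ b′ → mix α a b + mix α a′ b′ ≡ mix α (a + a′) (b + b′)
mix-+ = solve 5 (λ α a b a′ b′ →
    (α :* a :+ (con 1ℚ :- α) :* b) :+ (α :* a′ :+ (con 1ℚ :- α) :* b′)
      := α :* (a :+ a′) :+ (con 1ℚ :- α) :* (b :+ b′)) refl

*-distribˡ-mix : ∀ c α a b → c * mix α a b ≡ mix α (c * a) (c * b)
*-distribˡ-mix = solve 4 (λ c α a b →
    c :* (α :* a :+ (con 1ℚ :- α) :* b) := α :* (c :* a) :+ (con 1ℚ :- α) :* (c :* b)) refl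

mix-mono : 0ℚ ≤ α → α ≤ 1ℚ → a ≤ a′ → b ≤ b′ → mix α a b ≤ mix α a′ b′
mix-mono 0≤α α≤1 a≤a′ b≤b′ = +-mono-≤ (*-monoˡ-≤ 0≤α a≤a′) (*-monoˡ-≤ (p≤q⇒0≤q-p α≤1) b≤b′)

mix-monoˡ : α ≤ β → b ≤ a → mix α a b ≤ mix β a b
mix-monoˡ {α} {β} {b} {a} α≤β b≤a =
  ≤-by-difference ((β - α) * (a - b)) (0≤p*q (p≤q⇒0≤q-p α≤β) (p≤q⇒0≤q-p b≤a)) (difference α β a b)
  where
  difference : ∀ α β a b → mix β a b - mix α a b ≡ (β - α) * (a - b)
  difference = solve 4 (λ α β a b →
    (β :* a :+ (con 1ℚ :- β) :* b) :- (α :* a :+ (con 1ℚ :- α) :* b) := (β :- α) :* (a :- b)) refl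

Event : ℕ → Set
Event n = Subset n → Bool

infixr 6 _∧ᵉ_

_∧ᵉ_ : Event n → Event n → Event n
(E ∧ᵉ F) R = E R ∧ F R

contains : Fin n → Event n
contains x R = lookup R x

UpwardClosed : Event n → Set
UpwardClosed E = ∀ {R R′} → R ⊆ R′ → T (E R) → T (E R′)

DownwardClosed : Event n → Set
DownwardClosed E = ∀ {R R′} → R′ ⊆ R → T (E R) → T (E R′)

T-contrapose : ∀ {a b} → (T a → T b) → T (not b) → T (not a)
T-contrapose {false} _ _ = _
T-contrapose {true} {false} a⇒b _ = a⇒b _

not-upwardClosed : {E : Event n} → UpwardClosed E → DownwardClosed (not ∘ E)
not-upwardClosed up R′⊆R = T-contrapose (up R′⊆R)

Pr-false : ∀ α n → Pr α n (λ _ → false) ≡ 0ℚ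
Pr-false α zero    = refl
Pr-false α (suc n) = begin
  mix α (Pr α n (λ _ → false)) (Pr α n (λ _ → false))  ≡⟨ cong₂ (mix α) (Pr-false α n) (Pr-false α n) ⟩
  mix α 0ℚ 0ℚ                                          ≡⟨ mix-idem α 0ℚ ⟩
  0ℚ                                                   ∎
  where open ≡-Reasoning

Pr-split : (E F : Event n) →
  Pr α n E ≡ Pr α n (F ∧ᵉ E) + Pr α n (not ∘ F ∧ᵉ E)
Pr-split {zero} E F with F [] | E []
... | true  | true  = refl
... | true  | false = refl
... | false | true  = refl
... | false | false = refl
Pr-split {suc n} {α} E F = begin
  mix α (Pr α n E₁) (Pr α n E₀)                                       ≡⟨ cong₂ (mix α) (Pr-split E₁ F₁) (Pr-split E₀ F₀) ⟩
  mix α (Pr α n (F₁ ∧ᵉ E₁) + Pr α n (not ∘ F₁ ∧ᵉ E₁))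
        (Pr α n (F₀ ∧ᵉ E₀) + Pr α n (not ∘ F₀ ∧ᵉ E₀))                  ≡⟨ sym (mix-+ α _ _ _ _) ⟩
  mix α (Pr α n (F₁ ∧ᵉ E₁)) (Pr α n (F₀ ∧ᵉ E₀))
    + mix α (Pr α n (not ∘ F₁ ∧ᵉ E₁)) (Pr α n (not ∘ F₀ ∧ᵉ E₀))       ∎
  where
  open ≡-Reasoning
  E₁ E₀ F₁ F₀ : Event n
  E₁ = E ∘ (inside ∷_)
  E₀ = E ∘ (outside ∷_)
  F₁ = F ∘ (inside ∷_)
  F₀ = F ∘ (outside ∷_)

Pr-complement : (E : Event n) → Pr α n E + Pr α n (not ∘ E) ≡ 1ℚ
Pr-complement {zero} E with E []
... | true  = refl
... | false = refl
Pr-complement {suc n} {α} E = begin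
  mix α (Pr α n E₁) (Pr α n E₀) + mix α (Pr α n (not ∘ E₁)) (Pr α n (not ∘ E₀))
    ≡⟨ mix-+ α _ _ _ _ ⟩
  mix α (Pr α n E₁ + Pr α n (not ∘ E₁)) (Pr α n E₀ + Pr α n (not ∘ E₀))
    ≡⟨ cong₂ (mix α) (Pr-complement E₁) (Pr-complement E₀) ⟩
  mix α 1ℚ 1ℚ
    ≡⟨ mix-idem α 1ℚ ⟩
  1ℚ ∎
  where
  open ≡-Reasoning
  E₁ E₀ : Event n
  E₁ = E ∘ (inside ∷_)
  E₀ = E ∘ (outside ∷_)

module _ (0≤α : 0ℚ ≤ α) (α≤1 : α ≤ 1ℚ) where

  Pr-mono : {E F : Event n} → (∀ R → T (E R) → T (F R)) → Pr α n E ≤ Pr α n F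
  Pr-mono {zero} {E} {F} E⇒F with E [] | F [] | E⇒F []
  ... | true  | true  | _   = ≤-refl
  ... | true  | false | E⇒F = ⊥-elim (E⇒F _)
  ... | false | true  | _   = nonNegative⁻¹ 1ℚ
  ... | false | false | _   = ≤-refl
  Pr-mono {suc n} E⇒F =
    mix-mono 0≤α α≤1 (Pr-mono (E⇒F ∘ (inside ∷_))) (Pr-mono (E⇒F ∘ (outside ∷_)))

  Pr-nonNeg : (E : Event n) → 0ℚ ≤ Pr α n E
  Pr-nonNeg {n} E = subst (_≤ Pr α n E) (Pr-false α n) (Pr-mono {n = n} {E = λ _ → false} (λ _ ()))

  -- Deleting x maps {x ∈ R} ∩ G injectively into {x ∉ R} ∩ G and changes the
  -- weight of each R by the factor (1-α)/α.
  Pr-removeElement : (x : Fin n) (G : Event n) → DownwardClosed G →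
    (1ℚ - α) * Pr α n (contains x ∧ᵉ G) ≤ α * Pr α n (not ∘ contains x ∧ᵉ G)
  Pr-removeElement {suc n} Fin.zero G down = begin
    (1ℚ - α) * mix α P₁ (Pr α n (λ _ → false))  ≡⟨ cong (λ z → (1ℚ - α) * mix α P₁ z) (Pr-false α n) ⟩
    (1ℚ - α) * mix α P₁ 0ℚ                      ≡⟨ left α P₁ ⟩
    α * (1ℚ - α) * P₁                           ≤⟨ *-monoˡ-≤ (0≤p*q 0≤α (p≤q⇒0≤q-p α≤1)) P₁≤P₀ ⟩
    α * (1ℚ - α) * P₀                           ≡⟨ right α P₀ ⟩
    α * mix α 0ℚ P₀                             ≡⟨ cong (λ z → α * mix α z P₀) (sym (Pr-false α n)) ⟩
    α * mix α (Pr α n (λ _ → false)) P₀         ∎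
    where
    open ≤-Reasoning
    P₁ = Pr α n (G ∘ (inside ∷_))
    P₀ = Pr α n (G ∘ (outside ∷_))
    P₁≤P₀ : P₁ ≤ P₀
    P₁≤P₀ = Pr-mono {E = G ∘ (inside ∷_)} (λ R → down (out⊆ ⊆-refl))
    left : ∀ α a → (1ℚ - α) * mix α a 0ℚ ≡ α * (1ℚ - α) * a
    left = solve 2 (λ α a → (con 1ℚ :- α) :* (α :* a :+ (con 1ℚ :- α) :* con 0ℚ)
                              := α :* (con 1ℚ :- α) :* a) refl
    right : ∀ α b → α * (1ℚ - α) * b ≡ α * mix α 0ℚ b
    right = solve 2 (λ α b → α :* (con 1ℚ :- α) :* b
                              := α :* (α :* con 0ℚ :+ (con 1ℚ :- α) :* b)) refl
  Pr-removeElement {suc n} (Fin.suc y) G down = begin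
    (1ℚ - α) * mix α A₁ A₀              ≡⟨ *-distribˡ-mix (1ℚ - α) α A₁ A₀ ⟩
    mix α ((1ℚ - α) * A₁) ((1ℚ - α) * A₀) ≤⟨ mix-mono 0≤α α≤1 (removeAfter inside) (removeAfter outside) ⟩
    mix α (α * B₁) (α * B₀)             ≡⟨ sym (*-distribˡ-mix α α B₁ B₀) ⟩
    α * mix α B₁ B₀                     ∎
    where
    open ≤-Reasoning
    A₁ = Pr α n (contains y ∧ᵉ G ∘ (inside ∷_))
    A₀ = Pr α n (contains y ∧ᵉ G ∘ (outside ∷_))
    B₁ = Pr α n (not ∘ contains y ∧ᵉ G ∘ (inside ∷_))
    B₀ = Pr α n (not ∘ contains y ∧ᵉ G ∘ (outside ∷_))
    removeAfter : ∀ s → (1ℚ - α) * Pr α n (contains y ∧ᵉ G ∘ (s ∷_))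
                        ≤ α * Pr α n (not ∘ contains y ∧ᵉ G ∘ (s ∷_))
    removeAfter s = Pr-removeElement y (G ∘ (s ∷_)) (down ∘ s⊆s)

Pr-monoˡ-≤ : {E : Event n} → UpwardClosed E → 0ℚ ≤ α → α ≤ β → β ≤ 1ℚ → Pr α n E ≤ Pr β n E
Pr-monoˡ-≤ {zero} up 0≤α α≤β β≤1 = ≤-refl
Pr-monoˡ-≤ {suc n} {α} {β} {E} up 0≤α α≤β β≤1 = begin
  mix α (Pr α n E₁) (Pr α n E₀)  ≤⟨ mix-mono 0≤α (≤-trans α≤β β≤1) (Pr-monoˡ-≤ (up ∘ s⊆s) 0≤α α≤β β≤1)
                                                                    (Pr-monoˡ-≤ (up ∘ s⊆s) 0≤α α≤β β≤1) ⟩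
  mix α (Pr β n E₁) (Pr β n E₀)  ≤⟨ mix-monoˡ α≤β (Pr-mono (≤-trans 0≤α α≤β) β≤1 {n = n} {E = E₀} (λ R → up (out⊆ ⊆-refl))) ⟩
  mix β (Pr β n E₁) (Pr β n E₀)  ∎
  where
  open ≤-Reasoning
  E₁ E₀ : Event n
  E₁ = E ∘ (inside ∷_)
  E₀ = E ∘ (outside ∷_)

1-≤Pr⇒Pr-not≤ : (E : Event n) → 1ℚ - c ≤ Pr α n E → Pr α n (not ∘ E) ≤ c
1-≤Pr⇒Pr-not≤ E = complement-≤ (Pr-complement E)

Pr-not≤⇒1-≤Pr : (E : Event n) → Pr α n (not ∘ E) ≤ c → 1ℚ - c ≤ Pr α n E
Pr-not≤⇒1-≤Pr E = complement-≥ (Pr-complement E)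

Pr-downwardClosed≤2×avoiding : 0ℚ ≤ α → α < 1ℚ → α + α ≤ 1ℚ →
  (x : Fin n) (G : Event n) → DownwardClosed G →
  Pr α n G ≤ Pr α n (not ∘ contains x ∧ᵉ G) + Pr α n (not ∘ contains x ∧ᵉ G)
Pr-downwardClosed≤2×avoiding {α} {n} 0≤α α<1 α+α≤1 x G down = begin
  Pr α n G                                         ≡⟨ Pr-split G (contains x) ⟩
  Pr α n (contains x ∧ᵉ G) + Pr α n Avoiding       ≤⟨ +-monoˡ-≤ (Pr α n Avoiding) inside≤avoiding ⟩
  Pr α n Avoiding + Pr α n Avoiding                ∎
  where
  open ≤-Reasoning
  α≤1 = <⇒≤ α<1
  Avoiding = not ∘ contains x ∧ᵉ G
  inside≤avoiding : Pr α n (contains x ∧ᵉ G) ≤ Pr α n Avoiding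
  inside≤avoiding = *-cancelˡ-≤-pos (1ℚ - α) {{positive (p<q⇒0<q-p α<1)}} (begin
    (1ℚ - α) * Pr α n (contains x ∧ᵉ G)  ≤⟨ Pr-removeElement 0≤α α≤1 x G down ⟩
    α * Pr α n Avoiding                  ≤⟨ *-monoʳ-≤-nonNeg (Pr α n Avoiding) {{nonNegative (Pr-nonNeg 0≤α α≤1 Avoiding)}}
                                                            (p+p≤1⇒p≤1-p {α} α+α≤1) ⟩
    (1ℚ - α) * Pr α n Avoiding           ∎)

T-does⁻ : ∀ {P : Set} (P? : Dec P) → T (does P?) → P
T-does⁻ (yes p) _ = p

T-does⁺ : ∀ {P : Set} (P? : Dec P) → P → T (does P?)
T-does⁺ (yes _) _ = _
T-does⁺ (no ¬p) p = ¬p p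

kernel⊆ : ∀ {k} (N : Fin k → Subset n) (i : Fin k) → kernel N ⊆ N i
kernel⊆ N Fin.zero    x∈K = proj₁ (x∈p∩q⁻ _ _ x∈K)
kernel⊆ N (Fin.suc i) x∈K = kernel⊆ (N ∘ Fin.suc) i (proj₂ (x∈p∩q⁻ _ _ x∈K))

⊆∧≢⇒⊂ : {p q : Subset n} → p ⊆ q → p ≢ q → p ⊂ q
⊆∧≢⇒⊂ {p = p} {q} p⊆q p≢q with any? (λ x → x ∈? q ×-dec ¬? (x ∈? p))
... | yes witness = p⊆q , witness
... | no ∄witness = ⊥-elim (p≢q (⊆-antisym p⊆q q⊆p))
  where
  q⊆p : q ⊆ p
  q⊆p {x} x∈q with x ∈? p
  ... | yes x∈p = x∈p
  ... | no  x∉p = ⊥-elim (∄witness (x , x∈q , x∉p))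

∪-monoˡ-⊆ : {R R′ : Subset n} (K : Subset n) → R ⊆ R′ → R ∪ K ⊆ R′ ∪ K
∪-monoˡ-⊆ {R = R} K R⊆R′ x∈R∪K with x∈p∪q⁻ R K x∈R∪K
... | inj₁ x∈R = x∈p∪q⁺ (inj₁ (R⊆R′ x∈R))
... | inj₂ x∈K = x∈p∪q⁺ (inj₂ x∈K)

module _ {k} (N : Fin k → Subset n) (i : Fin k) (K : Subset n) where

  covers? : ∀ R → Dec (∃ λ j → N j ⊆ R ∪ K)
  covers? R = any? (λ j → N j ⊆? (R ∪ K))

  coversExcept? : ∀ R → Dec (∃ λ j → j ≢ i × N j ⊆ R ∪ K)
  coversExcept? R = any? (λ j → ¬? (j Fin.≟ i) ×-dec (N j ⊆? (R ∪ K)))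

  coveredByExcept-upwardClosed : UpwardClosed (coveredByExcept N i K)
  coveredByExcept-upwardClosed {R} {R′} R⊆R′ covered with T-does⁻ (coversExcept? R) covered
  ... | j , j≢i , Nj⊆R∪K = T-does⁺ (coversExcept? R′) (j , j≢i , ∪-monoˡ-⊆ K R⊆R′ ∘ Nj⊆R∪K)

  coveredBy⇒coveredByExcept : ∀ {x R} → x ∈ N i → x ∉ K → T (not (contains x R)) →
    T (coveredBy N K R) → T (coveredByExcept N i K R)
  coveredBy⇒coveredByExcept {x} {R} x∈Ni x∉K x∉R covered with T-does⁻ (covers? R) covered
  ... | j , Nj⊆R∪K with j Fin.≟ i
  ...   | no j≢i = T-does⁺ (coversExcept? R) (j , j≢i , Nj⊆R∪K)
  ...   | yes refl with x∈p∪q⁻ R K (Nj⊆R∪K x∈Ni)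
  ...     | inj₂ x∈K = ⊥-elim (x∉K x∈K)
  ...     | inj₁ x∈R with lookup R x | []=⇒lookup x∈R
  ...       | true | _ = ⊥-elim x∉R

Pr-notCoveredByExcept≤2× : 0ℚ ≤ α → α < 1ℚ → α + α ≤ 1ℚ →
  ∀ {k} (N : Fin k → Subset n) (i : Fin k) → kernel N ≢ N i →
  Pr α n (not ∘ coveredByExcept N i (kernel N))
    ≤ Pr α n (not ∘ coveredBy N (kernel N)) + Pr α n (not ∘ coveredBy N (kernel N))
Pr-notCoveredByExcept≤2× {α} {n} 0≤α α<1 α+α≤1 N i K≢Ni = begin
  Pr α n Uncovered                                   ≤⟨ Pr-downwardClosed≤2×avoiding 0≤α α<1 α+α≤1 x Uncovered
                                                          (not-upwardClosed (coveredByExcept-upwardClosed N i K)) ⟩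
  Pr α n Avoiding + Pr α n Avoiding                  ≤⟨ +-mono-≤ avoiding≤ avoiding≤ ⟩
  Pr α n (not ∘ coveredBy N K) + Pr α n (not ∘ coveredBy N K) ∎
  where
  open ≤-Reasoning
  K = kernel N
  Uncovered = not ∘ coveredByExcept N i K
  K⊂Ni : K ⊂ N i
  K⊂Ni = ⊆∧≢⇒⊂ (kernel⊆ N i) K≢Ni
  x = proj₁ (proj₂ K⊂Ni)
  x∈Ni : x ∈ N i
  x∈Ni = proj₁ (proj₂ (proj₂ K⊂Ni))
  x∉K : x ∉ K
  x∉K = proj₂ (proj₂ (proj₂ K⊂Ni))
  Avoiding = not ∘ contains x ∧ᵉ Uncovered
  avoiding≤ : Pr α n Avoiding ≤ Pr α n (not ∘ coveredBy N K)
  avoiding≤ = Pr-mono 0≤α (<⇒≤ α<1) {E = Avoiding} λ R avoiding →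
    let x∉R , uncovered = Equivalence.to T-∧ avoiding in
    T-contrapose (coveredBy⇒coveredByExcept N i K {R = R} x∈Ni x∉K x∉R) uncovered

mainTheorem5 : ∀ {n k : ℕ} (N : Fin k → Subset n) → Injective _≡_ _≡_ N →
    (p ε : ℚ) → RobustSunflower p ε N → p + p ≤ 1ℚ →
    (i : Fin k) →
    1ℚ - (ε + ε) ≤ Pr (p + p) n (coveredByExcept N i (kernel N))
mainTheorem5 {n} N _ p ε ((0<p , p<1) , _ , K≢N , 1-ε≤Pr) p+p≤1 i = begin
  1ℚ - (ε + ε)       ≤⟨ Pr-not≤⇒1-≤Pr Covered uncovered≤2ε ⟩
  Pr p n Covered       ≤⟨ Pr-monoˡ-≤ (coveredByExcept-upwardClosed N i K) 0≤p (0≤p⇒p≤p+p 0≤p) p+p≤1 ⟩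
  Pr (p + p) n Covered ∎
  where
  open ≤-Reasoning
  K = kernel N
  Covered = coveredByExcept N i K
  0≤p = <⇒≤ 0<p
  failure≤ε : Pr p n (not ∘ coveredBy N K) ≤ ε
  failure≤ε = 1-≤Pr⇒Pr-not≤ (coveredBy N K) 1-ε≤Pr
  uncovered≤2ε : Pr p n (not ∘ Covered) ≤ ε + ε
  uncovered≤2ε = ≤-trans (Pr-notCoveredByExcept≤2× 0≤p p<1 p+p≤1 N i (K≢N i)) (+-mono-≤ failure≤ε failure≤ε)
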